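{- Every $\mathbf{LK_u}$-provable implicational Horn sequent $S$ has an $\mathbf{LK_u}$-proof of size $O(|S|^2)$.
   Context: Formulas. $\mathcal{L}_u$-formulas are built from atoms and constants $0,1$ by $\wedge,\vee,*,\to$. A sequent is $\Gamma\Rightarrow\Delta$ with $\Gamma,\Delta$ finite multisets. An $\mathcal{L}_u$-formula is implicational Horn if generated by $F::=p\mid1\mid \circledast_{i\in I}q_i\to p\mid p\to\circledast_{i\in I}q_i\mid F_1\wedge F_2$, with $p,q_i$ atoms, $I$ a nonempty finite set, and $\circledast_{i\in I}q_i$ the iterated $*$-product of the $q_i$. A sequent is implicational Horn if it is $\Gamma\Rightarrow p$ with $\Gamma$ a multiset of implicational Horn formulas and $p$ an atom. $\mathbf{LK_u}$ has axioms $A\Rightarrow A$, $\Rightarrow1$, $0\Rightarrow$ and rules: from $\Gamma\Rightarrow\Delta$ infer $\Gamma,1\Rightarrow\Delta$ and $\Gamma\Rightarrow0,\Delta$; from $\Gamma,A_i\Rightarrow\Delta$ infer $\Gamma,A_0\wedge A_1\Rightarrow\Delta$; from $\Gamma\Rightarrow A,\Delta$ and $\Gamma\Rightarrow B,\Delta$ infer $\Gamma\Rightarrow A\wedge B,\Delta$; from $\Gamma,A\Rightarrow\Delta$ and $\Gamma,B\Rightarrow\Delta$ infer $\Gamma,A\vee B\Rightarrow\Delta$; from $\Gamma\Rightarrow A_i,\Delta$ infer $\Gamma\Rightarrow A_0\vee A_1,\Delta$; from $\Gamma,A,B\Rightarrow\Delta$ infer $\Gamma,A*B\Rightarrow\Delta$;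 from $\Gamma\Rightarrow A,\Delta$ and $\Sigma\Rightarrow B,\Lambda$ infer $\Gamma,\Sigma\Rightarrow A*B,\Delta,\Lambda$; from $\Gamma\Rightarrow A,\Delta$ and $\Sigma,B\Rightarrow\Lambda$ infer $\Gamma,\Sigma,A\to B\Rightarrow\Delta,\Lambda$; from $\Gamma,A\Rightarrow B,\Delta$ infer $\Gamma\Rightarrow A\to B,\Delta$; cut: from $\Gamma\Rightarrow A,\Delta$ and $\Sigma,A\Rightarrow\Lambda$ infer $\Gamma,\Sigma\Rightarrow\Delta,\Lambda$; weakening (from $\Gamma\Rightarrow\Delta$ infer $\Gamma,A\Rightarrow\Delta$ and $\Gamma\Rightarrow A,\Delta$); contraction (from $\Gamma,A,A\Rightarrow\Delta$ infer $\Gamma,A\Rightarrow\Delta$; from $\Gamma\Rightarrow A,A,\Delta$ infer $\Gamma\Rightarrow A,\Delta$). Size = number of symbols. -}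

module Defs where

open import Data.Nat using (ℕ; zero; suc; _+_)
open import Data.List using (List; []; _∷_; _++_; [_])
open import Data.List.Relation.Binary.Permutation.Propositional using (_↭_)
open import Data.List.Relation.Unary.All using (All)

infixr 6 _∧_
infixr 5 _∨_
infixr 7 _⊛_
infixr 4 _⇒_

data Fm : Set where
  var : ℕ → Fm
  𝟘 𝟙 : Fm
  _∧_ _∨_ _⊛_ _⇒_ : Fm → Fm → Fm

fsize : Fm → ℕ
fsize (var _) = 1
fsize 𝟘 = 1
fsize 𝟙 = 1
fsize (A ∧ B) = suc (fsize A + fsize B)
fsize (A ∨ B) = suc (fsize A + fsize B)
fsize (A ⊛ B) = suc (fsize A + fsize B)
fsize (A ⇒ B) = suc (fsize A + fsize B)

lsize : List Fm → ℕ
lsize [] = 0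
lsize (A ∷ Γ) = fsize A + lsize Γ

-- size of the sequent Γ ⇒ Δ: symbols of all formulas plus the sequent arrow
ssize : List Fm → List Fm → ℕ
ssize Γ Δ = suc (lsize Γ + lsize Δ)

prod : ℕ → List ℕ → Fm
prod q [] = var q
prod q (r ∷ rs) = var q ⊛ prod r rs

data Horn : Fm → Set where
  h-atom : ∀ p → Horn (var p)
  h-one  : Horn 𝟙
  h-impL : ∀ q qs p → Horn (prod q qs ⇒ var p)
  h-impR : ∀ p q qs → Horn (var p ⇒ prod q qs)
  h-and  : ∀ {F G} → Horn F → Horn G → Horn (F ∧ G)

-- an implicational Horn sequent is  Γ ⇒ var p  with  All Horn Γ  (see Statement)

-- LK_u derivations. Sequents are lists; the multiset reading is obtained via
-- the rule `ex`, which only permutes and is not counted in the size.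
infix 3 _⊢_
data _⊢_ : List Fm → List Fm → Set where
  ex   : ∀ {Γ Γ' Δ Δ'} → Γ ↭ Γ' → Δ ↭ Δ' → Γ ⊢ Δ → Γ' ⊢ Δ'
  ax   : ∀ A → [ A ] ⊢ [ A ]
  ax1  : [] ⊢ [ 𝟙 ]
  ax0  : [ 𝟘 ] ⊢ []
  1L   : ∀ {Γ Δ} → Γ ⊢ Δ → 𝟙 ∷ Γ ⊢ Δ
  0R   : ∀ {Γ Δ} → Γ ⊢ Δ → Γ ⊢ 𝟘 ∷ Δ
  ∧L₀  : ∀ {Γ Δ A B} → A ∷ Γ ⊢ Δ → (A ∧ B) ∷ Γ ⊢ Δ
  ∧L₁  : ∀ {Γ Δ A B} → B ∷ Γ ⊢ Δ → (A ∧ B) ∷ Γ ⊢ Δ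
  ∧R   : ∀ {Γ Δ A B} → Γ ⊢ A ∷ Δ → Γ ⊢ B ∷ Δ → Γ ⊢ (A ∧ B) ∷ Δ
  ∨L   : ∀ {Γ Δ A B} → A ∷ Γ ⊢ Δ → B ∷ Γ ⊢ Δ → (A ∨ B) ∷ Γ ⊢ Δ
  ∨R₀  : ∀ {Γ Δ A B} → Γ ⊢ A ∷ Δ → Γ ⊢ (A ∨ B) ∷ Δ
  ∨R₁  : ∀ {Γ Δ A B} → Γ ⊢ B ∷ Δ → Γ ⊢ (A ∨ B) ∷ Δ
  ⊛L   : ∀ {Γ Δ A B} → A ∷ B ∷ Γ ⊢ Δ → (A ⊛ B) ∷ Γ ⊢ Δ
  ⊛R   : ∀ {Γ Δ Σ Λ A B} → Γ ⊢ A ∷ Δ → Σ ⊢ B ∷ Λ → Γ ++ Σ ⊢ (A ⊛ B) ∷ Δ ++ Λ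
  ⇒L   : ∀ {Γ Δ Σ Λ A B} → Γ ⊢ A ∷ Δ → B ∷ Σ ⊢ Λ → (A ⇒ B) ∷ Γ ++ Σ ⊢ Δ ++ Λ
  ⇒R   : ∀ {Γ Δ A B} → A ∷ Γ ⊢ B ∷ Δ → Γ ⊢ (A ⇒ B) ∷ Δ
  cut  : ∀ {Γ Δ Σ Λ A} → Γ ⊢ A ∷ Δ → A ∷ Σ ⊢ Λ → Γ ++ Σ ⊢ Δ ++ Λ
  wL   : ∀ {Γ Δ A} → Γ ⊢ Δ → A ∷ Γ ⊢ Δ
  wR   : ∀ {Γ Δ A} → Γ ⊢ Δ → Γ ⊢ A ∷ Δ
  cL   : ∀ {Γ Δ A} → A ∷ A ∷ Γ ⊢ Δ → A ∷ Γ ⊢ Δ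
  cR   : ∀ {Γ Δ A} → Γ ⊢ A ∷ A ∷ Δ → Γ ⊢ A ∷ Δ

-- size of a derivation: total number of symbols of all sequents occurring in it
-- (a permutation step does not create a new multiset-sequent, so it adds nothing)
dsize : ∀ {Γ Δ} → Γ ⊢ Δ → ℕ
dsize (ex _ _ d) = dsize d
dsize {Γ} {Δ} (ax _) = ssize Γ Δ
dsize {Γ} {Δ} ax1 = ssize Γ Δ
dsize {Γ} {Δ} ax0 = ssize Γ Δ
dsize {Γ} {Δ} (1L d) = ssize Γ Δ + dsize d
dsize {Γ} {Δ} (0R d) = ssize Γ Δ + dsize d
dsize {Γ} {Δ} (∧L₀ d) = ssize Γ Δ + dsize d
dsize {Γ} {Δ} (∧L₁ d) = ssize Γ Δ + dsize d
dsize {Γ} {Δ} (∧R d e) = ssize Γ Δ + dsize d + dsize e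
dsize {Γ} {Δ} (∨L d e) = ssize Γ Δ + dsize d + dsize e
dsize {Γ} {Δ} (∨R₀ d) = ssize Γ Δ + dsize d
dsize {Γ} {Δ} (∨R₁ d) = ssize Γ Δ + dsize d
dsize {Γ} {Δ} (⊛L d) = ssize Γ Δ + dsize d
dsize {Γ} {Δ} (⊛R d e) = ssize Γ Δ + dsize d + dsize e
dsize {Γ} {Δ} (⇒L d e) = ssize Γ Δ + dsize d + dsize e
dsize {Γ} {Δ} (⇒R d) = ssize Γ Δ + dsize d
dsize {Γ} {Δ} (cut d e) = ssize Γ Δ + dsize d + dsize e
dsize {Γ} {Δ} (wL d) = ssize Γ Δ + dsize d
dsize {Γ} {Δ} (wR d) = ssize Γ Δ + dsize d
dsize {Γ} {Δ} (cL d) = ssize Γ Δ + dsize d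
dsize {Γ} {Δ} (cR d) = ssize Γ Δ + dsize d

-- A Horn context splits into clauses: atoms, rules ⊛qᵢ → a and rules a → ⊛qᵢ.
-- Forward chaining fires a rule whose premises are atoms of the context, replacing
-- it by its conclusions. When no rule can fire, making exactly the present atoms true
-- satisfies the context, so by soundness a provable goal p is among them and follows
-- by weakening. Read backwards, each firing is one ⇒L whose antecedent is proved from
-- (or whose product is split into) atoms, followed by contractions against copies
-- already present. Antecedents never exceed twice |Γ| and each rule fires once, so
-- O(|Γ|) inferences on sequents of size O(|S|) suffice.
{-# OPTIONS --safe #-}
module Submission where

open import Defs
open import Data.Bool using (Bool; true; false; not; T) renaming (_∧_ to _&&_; _∨_ to _||_)
open import Data.Bool.Properties using (T-∧; T-∨; T?)
open import Data.Empty using (⊥; ⊥-elim)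
open import Data.List using (List; []; _∷_; _++_; [_]; map; length)
open import Data.List.Properties using (map-++; map-∘; ++-assoc; ++-identityʳ; length-map)
open import Data.List.Membership.Propositional using (_∈_; find)
open import Data.List.Membership.Propositional.Properties using (∈-∃++; ∈-map⁺)
open import Data.List.Relation.Binary.Permutation.Propositional
  using (_↭_; prep; swap; ↭-refl; ↭-sym; ↭-trans; ↭-reflexive)
open import Data.List.Relation.Binary.Permutation.Propositional.Properties
  using (shift; shifts; ++-comm; map⁺; ↭-length; All-resp-↭; Any-resp-↭; ∈-resp-↭)
open import Data.List.Relation.Unary.All as All using (All; []; _∷_)
open import Data.List.Relation.Unary.All.Properties using (++⁻ˡ; ++⁻ʳ; ++⁻; map⁻; ¬Any⇒All¬)
  renaming (map⁺ to All-map⁺)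
open import Data.List.Relation.Unary.Any as Any using (Any; here; there; toSum; fromSum)
open import Data.List.Relation.Unary.Any.Properties using (++⁺ˡ; ++⁺ʳ; singleton⁻)
open import Data.Nat using (ℕ; suc; _+_; _*_; _^_; _≤_; _<_; z≤n; s≤s; _≟_)
open import Data.Nat.Induction using (<-wellFounded)
open import Data.Nat.ListAction using (sum)
open import Data.Nat.ListAction.Properties using (sum-↭)
open import Data.Nat.Properties
open import Data.Nat.Tactic.RingSolver using (solve-∀)
open import Algebra.Properties.CommutativeSemigroup +-commutativeSemigroup using (interchange)
open import Data.Product using (Σ; ∃; _×_; _,_; proj₁; proj₂)
open import Data.Sum using (inj₁; inj₂; [_,_]′) renaming (map₁ to ⊎-map₁)
open import Function using (_∘_; id; const; _⇔_; mk⇔; Equivalence)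
open import Induction.WellFounded using (Acc; acc)
open import Relation.Binary.PropositionalEquality using (_≡_; refl; sym; trans; cong; subst; module ≡-Reasoning)
open import Relation.Nullary using (¬_; Dec; yes; no)
open import Relation.Nullary.Decidable using (isYes; toWitness; fromWitness; map′)

open Equivalence using (to; from)

⟦_⟧ : Fm → (ℕ → Bool) → Bool
⟦ var x ⟧ v = v x
⟦ 𝟘 ⟧ v = false
⟦ 𝟙 ⟧ v = true
⟦ A ∧ B ⟧ v = ⟦ A ⟧ v && ⟦ B ⟧ v
⟦ A ∨ B ⟧ v = ⟦ A ⟧ v || ⟦ B ⟧ v
⟦ A ⊛ B ⟧ v = ⟦ A ⟧ v && ⟦ B ⟧ v
⟦ A ⇒ B ⟧ v = not (⟦ A ⟧ v) || ⟦ B ⟧ v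

Holds : (ℕ → Bool) → Fm → Set
Holds v A = T (⟦ A ⟧ v)

infix 3 _⊨_
_⊨_ : List Fm → List Fm → Set
Γ ⊨ Δ = ∀ v → All (Holds v) Γ → Any (Holds v) Δ

T-not-∨ : ∀ {x y} → T (not x || y) ⇔ (T x → T y)
T-not-∨ {false} = mk⇔ (λ _ ()) (λ _ → _)
T-not-∨ {true}  = mk⇔ (λ y _ → y) (λ f → f _)

holds-prod⁺ : ∀ {v} q qs → All (T ∘ v) (q ∷ qs) → Holds v (prod q qs)
holds-prod⁺ q [] (t ∷ []) = t
holds-prod⁺ q (r ∷ rs) (t ∷ ts) = from T-∧ (t , holds-prod⁺ r rs ts)

holds-prod⁻ : ∀ {v} q qs → Holds v (prod q qs) → All (T ∘ v) (q ∷ qs)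
holds-prod⁻ q [] t = t ∷ []
holds-prod⁻ q (r ∷ rs) t = proj₁ (to T-∧ t) ∷ holds-prod⁻ r rs (proj₂ (to T-∧ t))

here-map : ∀ {P : Fm → Set} {A B Δ} → (P A → P B) → Any P (A ∷ Δ) → Any P (B ∷ Δ)
here-map f = fromSum ∘ ⊎-map₁ f ∘ toSum

sound : ∀ {Γ Δ} → Γ ⊢ Δ → Γ ⊨ Δ
sound (ex Γ↭ Δ↭ d) v γ = Any-resp-↭ Δ↭ (sound d v (All-resp-↭ (↭-sym Γ↭) γ))
sound (ax A) v (a ∷ []) = here a
sound ax1 v [] = here _
sound ax0 v (() ∷ [])
sound (1L d) v (_ ∷ γ) = sound d v γ
sound (0R d) v γ = there (sound d v γ)
sound (∧L₀ d) v (ab ∷ γ) = sound d v (proj₁ (to T-∧ ab) ∷ γ)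
sound (∧L₁ d) v (ab ∷ γ) = sound d v (proj₂ (to T-∧ ab) ∷ γ)
sound (∧R d e) v γ with sound d v γ | sound e v γ
... | here a  | here b  = here (from T-∧ (a , b))
... | there δ | _       = there δ
... | here _  | there δ = there δ
sound (∨L d e) v (ab ∷ γ) = [ (λ a → sound d v (a ∷ γ)) , (λ b → sound e v (b ∷ γ)) ]′ (to T-∨ ab)
sound (∨R₀ d) v γ = here-map (λ a → from T-∨ (inj₁ a)) (sound d v γ)
sound (∨R₁ d) v γ = here-map (λ b → from T-∨ (inj₂ b)) (sound d v γ)
sound (⊛L d) v (ab ∷ γ) = sound d v (proj₁ (to T-∧ ab) ∷ proj₂ (to T-∧ ab) ∷ γ)
sound (⊛R {Γ} {Δ} d e) v γ with sound d v (++⁻ˡ Γ γ) | sound e v (++⁻ʳ Γ γ)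
... | here a  | here b  = here (from T-∧ (a , b))
... | there δ | _       = there (++⁺ˡ δ)
... | here _  | there δ = there (++⁺ʳ Δ δ)
sound (⇒L {Γ} {Δ} d e) v (f ∷ γ) with sound d v (++⁻ˡ Γ γ)
... | here a  = ++⁺ʳ Δ (sound e v (to T-not-∨ f a ∷ ++⁻ʳ Γ γ))
... | there δ = ++⁺ˡ δ
sound (⇒R {A = A} d) v γ with T? (⟦ A ⟧ v)
... | yes a = here-map (λ b → from T-not-∨ (const b)) (sound d v (a ∷ γ))
... | no ¬a = here (from T-not-∨ (⊥-elim ∘ ¬a))
sound (cut {Γ} {Δ} d e) v γ with sound d v (++⁻ˡ Γ γ)
... | here a  = ++⁺ʳ Δ (sound e v (a ∷ ++⁻ʳ Γ γ))
... | there δ = ++⁺ˡ δ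
sound (wL d) v (_ ∷ γ) = sound d v γ
sound (wR d) v γ = there (sound d v γ)
sound (cL d) v (a ∷ γ) = sound d v (a ∷ a ∷ γ)
sound (cR d) v γ = [ here , id ]′ (toSum (sound d v γ))

∈⇒↭ : ∀ {A : Set} {x : A} {xs} → x ∈ xs → ∃ λ ys → xs ↭ x ∷ ys
∈⇒↭ x∈xs with ys , zs , refl ← ∈-∃++ x∈xs = ys ++ zs , shift _ ys zs

Any-split : ∀ {A : Set} {P : A → Set} {xs} → Any P xs → ∃ λ ys → ∃ λ x → ∃ λ zs → xs ≡ ys ++ x ∷ zs × P x
Any-split any =
  let x , x∈xs , px = find any
      ys , zs , xs≡ = ∈-∃++ x∈xs
  in ys , x , zs , xs≡ , px

lsize-++ : ∀ Γ Θ → lsize (Γ ++ Θ) ≡ lsize Γ + lsize Θ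
lsize-++ [] Θ = refl
lsize-++ (A ∷ Γ) Θ = trans (cong (fsize A +_) (lsize-++ Γ Θ)) (sym (+-assoc (fsize A) _ _))

lsize-++ʳ : ∀ Γ Θ → lsize Θ ≤ lsize (Γ ++ Θ)
lsize-++ʳ Γ Θ = ≤-trans (m≤n+m (lsize Θ) (lsize Γ)) (≤-reflexive (sym (lsize-++ Γ Θ)))

lsize≡sum : ∀ Γ → lsize Γ ≡ sum (map fsize Γ)
lsize≡sum [] = refl
lsize≡sum (A ∷ Γ) = cong (fsize A +_) (lsize≡sum Γ)

lsize-↭ : ∀ {Γ Γ'} → Γ ↭ Γ' → lsize Γ ≡ lsize Γ'
lsize-↭ {Γ} {Γ'} Γ↭ = trans (lsize≡sum Γ) (trans (sum-↭ (map⁺ fsize Γ↭)) (sym (lsize≡sum Γ')))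

lsize-atoms : ∀ xs → lsize (map var xs) ≡ length xs
lsize-atoms [] = refl
lsize-atoms (x ∷ xs) = cong suc (lsize-atoms xs)

length≤prod : ∀ q qs → length (q ∷ qs) ≤ fsize (prod q qs)
length≤prod q [] = ≤-refl
length≤prod q (r ∷ rs) = s≤s (m≤n⇒m≤1+n (length≤prod r rs))

atoms≤prod : ∀ q qs → lsize (map var (q ∷ qs)) ≤ fsize (prod q qs)
atoms≤prod q qs = ≤-trans (≤-reflexive (lsize-atoms (q ∷ qs))) (length≤prod q qs)

-- Γ ⊢⟨ k ⟩ Δ is a derivation of size at most k * B. Every combinator below demands
-- that its conclusion fit in B, so k counts inferences.
module Bounded (B : ℕ) where

  -- A record rather than the bare inequality, since ssize unfolds and would keep
  -- Γ and Δ from being inferred.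
  record Fits (Γ Δ : List Fm) : Set where
    constructor fits
    field ssize≤ : ssize Γ Δ ≤ B

  fits-≤ : ∀ {Γ Δ Γ' Δ'} → ssize Γ Δ ≤ ssize Γ' Δ' → Fits Γ' Δ' → Fits Γ Δ
  fits-≤ le (fits f) = fits (≤-trans le f)

  fits-lsize : ∀ {Γ Γ' Δ} → lsize Γ ≤ lsize Γ' → Fits Γ' Δ → Fits Γ Δ
  fits-lsize {Δ = Δ} le = fits-≤ (s≤s (+-monoˡ-≤ (lsize Δ) le))

  fits-↭ : ∀ {Γ Γ' Δ} → Γ ↭ Γ' → Fits Γ' Δ → Fits Γ Δ
  fits-↭ Γ↭ = fits-lsize (≤-reflexive (lsize-↭ Γ↭))

  infix 3 _⊢⟨_⟩_
  record _⊢⟨_⟩_ (Γ : List Fm) (k : ℕ) (Δ : List Fm) : Set where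
    constructor _,_
    field
      derivation : Γ ⊢ Δ
      size≤ : dsize derivation ≤ k * B
  open _⊢⟨_⟩_ public

  exᵇ : ∀ {Γ Γ' Δ k} → Γ ↭ Γ' → Γ ⊢⟨ k ⟩ Δ → Γ' ⊢⟨ k ⟩ Δ
  exᵇ Γ↭ (d , s) = ex Γ↭ ↭-refl d , s

  relax : ∀ {Γ Δ k k'} → k ≤ k' → Γ ⊢⟨ k ⟩ Δ → Γ ⊢⟨ k' ⟩ Δ
  relax k≤k' (d , s) = d , ≤-trans s (*-monoˡ-≤ B k≤k')

  recount : ∀ {Γ Δ k k'} → k ≡ k' → Γ ⊢⟨ k ⟩ Δ → Γ ⊢⟨ k' ⟩ Δ
  recount refl d = d

  axᵇ : ∀ A → Fits [ A ] [ A ] → [ A ] ⊢⟨ 1 ⟩ [ A ]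
  axᵇ A (fits f) = ax A , ≤-trans f (≤-reflexive (sym (*-identityˡ B)))

  1Lᵇ : ∀ {Γ Δ k} → Fits (𝟙 ∷ Γ) Δ → Γ ⊢⟨ k ⟩ Δ → 𝟙 ∷ Γ ⊢⟨ suc k ⟩ Δ
  1Lᵇ (fits f) (d , s) = 1L d , +-mono-≤ f s

  wLᵇ : ∀ {Γ Δ A k} → Fits (A ∷ Γ) Δ → Γ ⊢⟨ k ⟩ Δ → A ∷ Γ ⊢⟨ suc k ⟩ Δ
  wLᵇ (fits f) (d , s) = wL d , +-mono-≤ f s

  cLᵇ : ∀ {Γ Δ A k} → Fits (A ∷ Γ) Δ → A ∷ A ∷ Γ ⊢⟨ k ⟩ Δ → A ∷ Γ ⊢⟨ suc k ⟩ Δ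
  cLᵇ (fits f) (d , s) = cL d , +-mono-≤ f s

  ∧L₀ᵇ : ∀ {Γ Δ A C k} → Fits ((A ∧ C) ∷ Γ) Δ → A ∷ Γ ⊢⟨ k ⟩ Δ → (A ∧ C) ∷ Γ ⊢⟨ suc k ⟩ Δ
  ∧L₀ᵇ (fits f) (d , s) = ∧L₀ d , +-mono-≤ f s

  ∧L₁ᵇ : ∀ {Γ Δ A C k} → Fits ((A ∧ C) ∷ Γ) Δ → C ∷ Γ ⊢⟨ k ⟩ Δ → (A ∧ C) ∷ Γ ⊢⟨ suc k ⟩ Δ
  ∧L₁ᵇ (fits f) (d , s) = ∧L₁ d , +-mono-≤ f s

  ⊛Lᵇ : ∀ {Γ Δ A C k} → Fits ((A ⊛ C) ∷ Γ) Δ → A ∷ C ∷ Γ ⊢⟨ k ⟩ Δ → (A ⊛ C) ∷ Γ ⊢⟨ suc k ⟩ Δ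
  ⊛Lᵇ (fits f) (d , s) = ⊛L d , +-mono-≤ f s

  two-premises : ∀ {s a b} k l → s ≤ B → a ≤ k * B → b ≤ l * B → s + a + b ≤ suc (k + l) * B
  two-premises k l s≤ a≤ b≤ = ≤-trans (+-mono-≤ (+-mono-≤ s≤ a≤) b≤)
    (≤-reflexive (trans (+-assoc B (k * B) (l * B)) (cong (B +_) (sym (*-distribʳ-+ B k l)))))

  ⊛Rᵇ : ∀ {Γ Δ Θ Λ A C k l} → Fits (Γ ++ Θ) ((A ⊛ C) ∷ Δ ++ Λ) →
        Γ ⊢⟨ k ⟩ A ∷ Δ → Θ ⊢⟨ l ⟩ C ∷ Λ → Γ ++ Θ ⊢⟨ suc (k + l) ⟩ (A ⊛ C) ∷ Δ ++ Λ
  ⊛Rᵇ {k = k} {l} (fits f) (d , s) (e , t) = ⊛R d e , two-premises k l f s t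

  ⇒Lᵇ : ∀ {Γ Δ Θ Λ A C k l} → Fits ((A ⇒ C) ∷ Γ ++ Θ) (Δ ++ Λ) →
        Γ ⊢⟨ k ⟩ A ∷ Δ → C ∷ Θ ⊢⟨ l ⟩ Λ → (A ⇒ C) ∷ Γ ++ Θ ⊢⟨ suc (k + l) ⟩ Δ ++ Λ
  ⇒Lᵇ {k = k} {l} (fits f) (d , s) (e , t) = ⇒L d e , two-premises k l f s t

  weaken-++ : ∀ {Γ Δ k} Θ → Fits (Θ ++ Γ) Δ → Γ ⊢⟨ k ⟩ Δ → Θ ++ Γ ⊢⟨ length Θ + k ⟩ Δ
  weaken-++ [] _ d = d
  weaken-++ (A ∷ Θ) fit d = wLᵇ fit (weaken-++ Θ (fits-lsize (m≤n+m _ (fsize A)) fit) d)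

  ax-∈ : ∀ {A Γ} → A ∈ Γ → Fits Γ [ A ] → Γ ⊢⟨ length Γ ⟩ [ A ]
  ax-∈ {A} {Γ} A∈Γ fit with Γ' , Γ↭ ← ∈⇒↭ A∈Γ =
    exᵇ (↭-sym Γ↭') (recount length≡ (weaken-++ Γ' (fits-↭ (↭-sym Γ↭') fit) (axᵇ A fitA)))
    where
      Γ↭' : Γ ↭ Γ' ++ [ A ]
      Γ↭' = ↭-trans Γ↭ (++-comm [ A ] Γ')
      length≡ : length Γ' + 1 ≡ length Γ
      length≡ = trans (+-comm (length Γ') 1) (sym (↭-length Γ↭))
      fitA : Fits [ A ] [ A ]
      fitA = fits-lsize (≤-trans (+-monoʳ-≤ (fsize A) z≤n) (≤-reflexive (sym (lsize-↭ Γ↭)))) fit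

  contract-copies : ∀ {Γ Δ k} Xs → All (_∈ Γ) Xs → Fits (Xs ++ Γ) Δ →
                    Xs ++ Γ ⊢⟨ k ⟩ Δ → Γ ⊢⟨ length Xs + k ⟩ Δ
  contract-copies [] [] _ d = d
  contract-copies {Γ} {Δ} {k} (X ∷ Xs) (X∈Γ ∷ Xs⊆Γ) fit d with Γ' , Γ↭ ← ∈⇒↭ X∈Γ =
    exᵇ (↭-sym Γ↭) (cLᵇ fitX (exᵇ (prep X Γ↭) dX))
    where
      shifted : Xs ++ X ∷ Γ ↭ X ∷ Xs ++ Γ
      shifted = shift X Xs Γ
      dX : X ∷ Γ ⊢⟨ length Xs + k ⟩ Δ
      dX = contract-copies Xs (All.map there Xs⊆Γ) (fits-↭ shifted fit) (exᵇ (↭-sym shifted) d)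
      fitX : Fits (X ∷ Γ') Δ
      fitX = fits-lsize (+-monoʳ-≤ (fsize X) (begin
        lsize Γ'            ≤⟨ m≤n+m (lsize Γ') (fsize X) ⟩
        lsize (X ∷ Γ')      ≡⟨ lsize-↭ (↭-sym Γ↭) ⟩
        lsize Γ             ≤⟨ lsize-++ʳ Xs Γ ⟩
        lsize (Xs ++ Γ)     ∎)) fit
        where open ≤-Reasoning

  ⇒L-from-context : ∀ {Γ Δ A C j k} Xs → All (_∈ (A ⇒ C) ∷ Γ) Xs → Fits (Xs ++ (A ⇒ C) ∷ Γ) Δ →
               Xs ⊢⟨ j ⟩ [ A ] → C ∷ Γ ⊢⟨ k ⟩ Δ → (A ⇒ C) ∷ Γ ⊢⟨ length Xs + suc (j + k) ⟩ Δ
  ⇒L-from-context {Γ} {A = A} {C} Xs Xs⊆ fit dA dC =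
    contract-copies Xs Xs⊆ fit (exᵇ (↭-sym shifted) (⇒Lᵇ (fits-↭ (↭-sym shifted) fit) dA dC))
    where
      shifted : Xs ++ (A ⇒ C) ∷ Γ ↭ (A ⇒ C) ∷ Xs ++ Γ
      shifted = shift (A ⇒ C) Xs Γ

  product-right : ∀ q qs → Fits (map var (q ∷ qs)) [ prod q qs ] →
                  map var (q ∷ qs) ⊢⟨ fsize (prod q qs) ⟩ [ prod q qs ]
  product-right q [] fit = axᵇ (var q) fit
  product-right q (r ∷ rs) fit =
    ⊛Rᵇ fit (axᵇ (var q) (fits-≤ (s≤s (s≤s (s≤s z≤n))) fit))
            (product-right r rs (fits-≤ (s≤s (s≤s (m≤n⇒m≤1+n (+-monoʳ-≤ (lsize (map var rs)) (m≤n+m _ 2))))) fit))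

  product-left : ∀ {Γ Δ k} q qs → Fits (prod q qs ∷ Γ) Δ →
                 map var (q ∷ qs) ++ Γ ⊢⟨ k ⟩ Δ → prod q qs ∷ Γ ⊢⟨ length qs + k ⟩ Δ
  product-left q [] _ d = d
  product-left {Γ} q (r ∷ rs) fit d =
    ⊛Lᵇ fit (exᵇ (swap _ _ ↭-refl) (product-left r rs fit' (exᵇ (↭-sym shifted) d)))
    where
      shifted : map var (r ∷ rs) ++ var q ∷ Γ ↭ var q ∷ map var (r ∷ rs) ++ Γ
      shifted = shift (var q) (map var (r ∷ rs)) Γ
      fit' : Fits (prod r rs ∷ var q ∷ Γ) _
      fit' = fits-lsize (≤-trans (≤-reflexive (+-suc (fsize (prod r rs)) (lsize Γ))) (n≤1+n _)) fit

data Clause : Set where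
  atom     : ℕ → Clause
  fromProd : ℕ → List ℕ → ℕ → Clause
  toProd   : ℕ → ℕ → List ℕ → Clause

⌜_⌝ : Clause → Fm
⌜ atom x ⌝ = var x
⌜ fromProd q qs a ⌝ = prod q qs ⇒ var a
⌜ toProd a q qs ⌝ = var a ⇒ prod q qs

⟪_⟫ : List Clause → List Fm
⟪_⟫ = map ⌜_⌝

⟪⟫-++ : ∀ C D → ⟪ C ++ D ⟫ ≡ ⟪ C ⟫ ++ ⟪ D ⟫
⟪⟫-++ = map-++ ⌜_⌝

⟪atoms⟫-++ : ∀ xs C → ⟪ map atom xs ++ C ⟫ ≡ map var xs ++ ⟪ C ⟫
⟪atoms⟫-++ xs C = trans (⟪⟫-++ (map atom xs) C) (cong (_++ ⟪ C ⟫) (sym (map-∘ xs)))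

⟪⟫-pick : ∀ C₁ c C₂ → ⟪ C₁ ++ c ∷ C₂ ⟫ ↭ ⌜ c ⌝ ∷ ⟪ C₁ ++ C₂ ⟫
⟪⟫-pick C₁ c C₂ = map⁺ ⌜_⌝ (shift c C₁ C₂)

⟪⟫-swap : ∀ C D Γ → ⟪ C ++ D ⟫ ++ Γ ↭ ⟪ D ⟫ ++ ⟪ C ⟫ ++ Γ
⟪⟫-swap C D Γ = ↭-trans (↭-reflexive (trans (cong (_++ Γ) (⟪⟫-++ C D)) (++-assoc ⟪ C ⟫ ⟪ D ⟫ Γ)))
                        (shifts ⟪ C ⟫ ⟪ D ⟫)

premises conclusions : Clause → List ℕ
premises (atom _) = []
premises (fromProd q qs _) = q ∷ qs
premises (toProd a _ _) = [ a ]
conclusions (atom x) = [ x ]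
conclusions (fromProd _ _ a) = [ a ]
conclusions (toProd _ q qs) = q ∷ qs

conclusions⇒clause : ∀ {v} c → All (T ∘ v) (conclusions c) → Holds v ⌜ c ⌝
conclusions⇒clause (atom x) (t ∷ []) = t
conclusions⇒clause (fromProd q qs a) (t ∷ []) = from T-not-∨ (const t)
conclusions⇒clause (toProd a q qs) ts = from T-not-∨ (const (holds-prod⁺ q qs ts))

conclusions≤ : ∀ c → lsize (map var (conclusions c)) ≤ fsize ⌜ c ⌝
conclusions≤ (atom x) = ≤-refl
conclusions≤ (fromProd q qs a) = s≤s z≤n
conclusions≤ (toProd a q qs) = ≤-trans (atoms≤prod q qs) (m≤n+m _ 2)

-- fireCost c is the number of inferences `discharge` spends on c; with one weakening
-- per conclusion on top, budget C pays for the whole saturation of C.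
fireCost weight : Clause → ℕ
fireCost (atom _) = 0
fireCost (fromProd q qs _) = length (q ∷ qs) + suc (fsize (prod q qs))
fireCost (toProd _ _ qs) = 3 + length qs
weight c = fireCost c + length (conclusions c)

budget : List Clause → ℕ
budget C = sum (map weight C)

weight≤ : ∀ c → weight c ≤ fsize ⌜ c ⌝ + fsize ⌜ c ⌝
weight≤ (atom x) = s≤s z≤n
weight≤ (fromProd q qs a) = begin
  length (q ∷ qs) + suc P + 1  ≤⟨ +-monoˡ-≤ 1 (+-monoˡ-≤ (suc P) (length≤prod q qs)) ⟩
  P + suc P + 1                ≡⟨ +-assoc P (suc P) 1 ⟩
  P + suc (P + 1)              ≤⟨ +-monoˡ-≤ (suc (P + 1)) (m≤n⇒m≤1+n (m≤m+n P 1)) ⟩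
  suc (P + 1) + suc (P + 1)    ∎
  where open ≤-Reasoning
        P = fsize (prod q qs)
weight≤ (toProd a q qs) =
  +-mono-≤ (s≤s (s≤s (length≤prod q qs))) (≤-trans (length≤prod q qs) (m≤n+m _ 2))

budget≤ : ∀ C → budget C ≤ lsize ⟪ C ⟫ + lsize ⟪ C ⟫
budget≤ [] = z≤n
budget≤ (c ∷ C) = ≤-trans (+-mono-≤ (weight≤ c) (budget≤ C)) (≤-reflexive (interchange c' c' C' C'))
  where c' = fsize ⌜ c ⌝
        C' = lsize ⟪ C ⟫

length≤budget : ∀ C → length C ≤ budget C
length≤budget [] = z≤n
length≤budget (c ∷ C) = +-mono-≤ (weight-pos c) (length≤budget C)
  where
    weight-pos : ∀ c → 1 ≤ weight c
    weight-pos (atom _) = s≤s z≤n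
    weight-pos (fromProd _ _ _) = s≤s z≤n
    weight-pos (toProd _ _ _) = s≤s z≤n

budget-atoms : ∀ xs C → budget (map atom xs ++ C) ≡ length xs + budget C
budget-atoms [] C = refl
budget-atoms (x ∷ xs) C = cong suc (budget-atoms xs C)

budget-fire : ∀ C₁ c C₂ →
              budget (C₁ ++ c ∷ C₂) ≡ fireCost c + budget (map atom (conclusions c) ++ C₁ ++ C₂)
budget-fire C₁ c C₂ = begin
  budget (C₁ ++ c ∷ C₂)                                      ≡⟨ sum-↭ (map⁺ weight (shift c C₁ C₂)) ⟩
  weight c + budget (C₁ ++ C₂)                               ≡⟨ +-assoc (fireCost c) _ _ ⟩
  fireCost c + (length (conclusions c) + budget (C₁ ++ C₂))  ≡⟨ cong (fireCost c +_) (sym (budget-atoms (conclusions c) _)) ⟩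
  fireCost c + budget (map atom (conclusions c) ++ C₁ ++ C₂) ∎
  where open ≡-Reasoning

Known : List Clause → ℕ → Set
Known C x = atom x ∈ C

atom≟ : ∀ x c → Dec (atom x ≡ c)
atom≟ x (atom y) = map′ (cong atom) (λ { refl → refl }) (x ≟ y)
atom≟ x (fromProd _ _ _) = no λ ()
atom≟ x (toProd _ _ _) = no λ ()

known? : ∀ C x → Dec (Known C x)
known? C x = Any.any? (atom≟ x) C

Enabled : List Clause → Clause → Set
Enabled C (atom _) = ⊥
Enabled C c = All (Known C) (premises c)

enabled? : ∀ C c → Dec (Enabled C c)
enabled? C (atom _) = no λ ()
enabled? C (fromProd q qs _) = All.all? (known? C) (q ∷ qs)
enabled? C (toProd a _ _) = All.all? (known? C) [ a ]

enabled⇒premises : ∀ {C} c → Enabled C c → All (Known C) (premises c)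
enabled⇒premises (fromProd _ _ _) e = e
enabled⇒premises (toProd _ _ _) e = e

fireCost-pos : ∀ {C} c → Enabled C c → 0 < fireCost c
fireCost-pos (fromProd _ _ _) _ = s≤s z≤n
fireCost-pos (toProd _ _ _) _ = s≤s z≤n

model : List Clause → ℕ → Bool
model C x = isYes (known? C x)

model-satisfies : ∀ C → All (¬_ ∘ Enabled C) C → All (Holds (model C)) ⟪ C ⟫
model-satisfies C stuck = All-map⁺ (All.tabulate λ {c} c∈C → holds c c∈C (All.lookup stuck c∈C))
  where
    holds : ∀ c → c ∈ C → ¬ Enabled C c → Holds (model C) ⌜ c ⌝
    holds (atom x) x∈C _ = fromWitness x∈C
    holds (fromProd q qs a) _ ¬e = from T-not-∨ (λ t → ⊥-elim (¬e (All.map toWitness (holds-prod⁻ q qs t))))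
    holds (toProd a q qs) _ ¬e = from (T-not-∨ {model C a}) (λ t → ⊥-elim (¬e (toWitness t ∷ [])))

fire-preserves-⊨ : ∀ {Δ} C₁ c C₂ → ⟪ C₁ ++ c ∷ C₂ ⟫ ⊨ Δ → ⟪ map atom (conclusions c) ++ C₁ ++ C₂ ⟫ ⊨ Δ
fire-preserves-⊨ C₁ c C₂ valid v sat =
  valid v (All-resp-↭ (↭-sym (⟪⟫-pick C₁ c C₂)) (conclusions⇒clause c (map⁻ new) ∷ rest))
  where
    split = ++⁻ (map var (conclusions c)) (subst (All (Holds v)) (⟪atoms⟫-++ (conclusions c) (C₁ ++ C₂)) sat)
    new = proj₁ split
    rest = proj₂ split

flatten : ∀ {F} → Horn F → List Clause
flatten (h-atom x) = [ atom x ]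
flatten h-one = []
flatten (h-impL q qs a) = [ fromProd q qs a ]
flatten (h-impR a q qs) = [ toProd a q qs ]
flatten (h-and hF hG) = flatten hF ++ flatten hG

flattenAll : ∀ {Γ} → All Horn Γ → List Clause
flattenAll [] = []
flattenAll (h ∷ hs) = flatten h ++ flattenAll hs

flatten-sound : ∀ {v F} (h : Horn F) → All (Holds v ∘ ⌜_⌝) (flatten h) → Holds v F
flatten-sound (h-atom x) (t ∷ []) = t
flatten-sound h-one [] = _
flatten-sound (h-impL q qs a) (t ∷ []) = t
flatten-sound (h-impR a q qs) (t ∷ []) = t
flatten-sound (h-and hF hG) ts =
  from T-∧ (flatten-sound hF (++⁻ˡ (flatten hF) ts) , flatten-sound hG (++⁻ʳ (flatten hF) ts))

flattenAll-sound : ∀ {v Γ} (hs : All Horn Γ) → All (Holds v ∘ ⌜_⌝) (flattenAll hs) → All (Holds v) Γ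
flattenAll-sound [] [] = []
flattenAll-sound (h ∷ hs) ts = flatten-sound h (++⁻ˡ (flatten h) ts) ∷ flattenAll-sound hs (++⁻ʳ (flatten h) ts)

lsize-⟪⟫-++ : ∀ C D → lsize ⟪ C ++ D ⟫ ≡ lsize ⟪ C ⟫ + lsize ⟪ D ⟫
lsize-⟪⟫-++ C D = trans (cong lsize (⟪⟫-++ C D)) (lsize-++ ⟪ C ⟫ ⟪ D ⟫)

lsize-flatten : ∀ {F} (h : Horn F) → lsize ⟪ flatten h ⟫ ≤ fsize F
lsize-flatten (h-atom x) = ≤-refl
lsize-flatten h-one = z≤n
lsize-flatten (h-impL q qs a) = ≤-reflexive (+-identityʳ _)
lsize-flatten (h-impR a q qs) = ≤-reflexive (+-identityʳ _)
lsize-flatten (h-and hF hG) = ≤-trans (≤-reflexive (lsize-⟪⟫-++ (flatten hF) (flatten hG)))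
  (m≤n⇒m≤1+n (+-mono-≤ (lsize-flatten hF) (lsize-flatten hG)))

lsize-flattenAll : ∀ {Γ} (hs : All Horn Γ) → lsize ⟪ flattenAll hs ⟫ ≤ lsize Γ
lsize-flattenAll [] = z≤n
lsize-flattenAll (h ∷ hs) = ≤-trans (≤-reflexive (lsize-⟪⟫-++ (flatten h) (flattenAll hs)))
  (+-mono-≤ (lsize-flatten h) (lsize-flattenAll hs))

-- N bounds the context being reconstructed; intermediate antecedents reach up to 2N.
module Doubling (N : ℕ) (Δ : List Fm) where

  open Bounded (suc (N + N + lsize Δ)) public

  fits-double : ∀ {Γ} → lsize Γ ≤ N + N → Fits Γ Δ
  fits-double le = fits (s≤s (+-monoˡ-≤ (lsize Δ) le))

  fits-++ : ∀ {Γ Θ} → lsize Θ ≤ N → lsize Γ ≤ N → Fits (Θ ++ Γ) Δ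
  fits-++ {Γ} {Θ} Θ≤ Γ≤ = fits-double (≤-trans (≤-reflexive (lsize-++ Θ Γ)) (+-mono-≤ Θ≤ Γ≤))

  unflatten : ∀ {F Γ k} (h : Horn F) → lsize (F ∷ Γ) ≤ N →
              ⟪ flatten h ⟫ ++ Γ ⊢⟨ k ⟩ Δ → F ∷ Γ ⊢⟨ 3 * fsize F + k ⟩ Δ
  unflatten (h-atom x) _ d = relax (m≤n+m _ _) d
  unflatten h-one small d = relax (s≤s (m≤n+m _ 2)) (1Lᵇ (fits-double (≤-trans small (m≤m+n N N))) d)
  unflatten (h-impL q qs a) _ d = relax (m≤n+m _ _) d
  unflatten (h-impR a q qs) _ d = relax (m≤n+m _ _) d
  unflatten {F ∧ G} {Γ} {k} (h-and hF hG) small d =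
    recount (cost (fsize F) (fsize G) k)
      (cLᵇ (fits-double (≤-trans small (m≤m+n N N)))
        (∧L₀ᵇ (fits-++ {Θ = [ F ∧ G ]} F∧G≤ small)
          (exᵇ (swap _ _ ↭-refl) (∧L₁ᵇ (fits-++ {Θ = [ F ∧ G ]} F∧G≤ FΓ≤) (exᵇ (swap _ _ ↭-refl) dF)))))
    where
      fF = ⟪ flatten hF ⟫
      F∧G≤ : lsize [ F ∧ G ] ≤ N
      F∧G≤ = ≤-trans (+-monoʳ-≤ (fsize (F ∧ G)) z≤n) small
      FGΓ≤ : lsize (F ∷ G ∷ Γ) ≤ N
      FGΓ≤ = ≤-trans (≤-reflexive (sym (+-assoc (fsize F) (fsize G) (lsize Γ)))) (≤-trans (n≤1+n _) small)
      FΓ≤ : lsize (F ∷ Γ) ≤ N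
      FΓ≤ = ≤-trans (+-monoʳ-≤ (fsize F) (m≤n+m (lsize Γ) (fsize G))) FGΓ≤
      GfFΓ≤ : lsize (G ∷ fF ++ Γ) ≤ N
      GfFΓ≤ = begin
        lsize (G ∷ fF ++ Γ)      ≡⟨ lsize-↭ (↭-sym (shift G fF Γ)) ⟩
        lsize (fF ++ G ∷ Γ)      ≡⟨ lsize-++ fF (G ∷ Γ) ⟩
        lsize fF + lsize (G ∷ Γ) ≤⟨ +-monoˡ-≤ _ (lsize-flatten hF) ⟩
        lsize (F ∷ G ∷ Γ)        ≤⟨ FGΓ≤ ⟩
        N                        ∎
        where open ≤-Reasoning
      dG : G ∷ fF ++ Γ ⊢⟨ 3 * fsize G + k ⟩ Δ
      dG = unflatten hG GfFΓ≤ (exᵇ (⟪⟫-swap (flatten hF) (flatten hG) Γ) d)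
      dF : F ∷ G ∷ Γ ⊢⟨ 3 * fsize F + (3 * fsize G + k) ⟩ Δ
      dF = unflatten hF FGΓ≤ (exᵇ (↭-sym (shift G fF Γ)) dG)
      cost : ∀ f g k → 3 + (3 * f + (3 * g + k)) ≡ 3 * suc (f + g) + k
      cost = solve-∀

  unflattenAll : ∀ {Γ R k} (hs : All Horn Γ) → lsize (Γ ++ R) ≤ N →
                 ⟪ flattenAll hs ⟫ ++ R ⊢⟨ k ⟩ Δ → Γ ++ R ⊢⟨ 3 * lsize Γ + k ⟩ Δ
  unflattenAll [] _ d = d
  unflattenAll {F ∷ Γ} {R} {k} (h ∷ hs) small d =
    recount (cost (fsize F) (lsize Γ) k)
      (unflatten h small (exᵇ (shifts Γ fh) (unflattenAll hs ΓfhR≤ (exᵇ (⟪⟫-swap (flatten h) (flattenAll hs) R) d))))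
    where
      fh = ⟪ flatten h ⟫
      ΓfhR≤ : lsize (Γ ++ fh ++ R) ≤ N
      ΓfhR≤ = begin
        lsize (Γ ++ fh ++ R)       ≡⟨ lsize-↭ (shifts Γ fh) ⟩
        lsize (fh ++ Γ ++ R)       ≡⟨ lsize-++ fh (Γ ++ R) ⟩
        lsize fh + lsize (Γ ++ R)  ≤⟨ +-monoˡ-≤ _ (lsize-flatten h) ⟩
        lsize (F ∷ Γ ++ R)         ≤⟨ small ⟩
        N                          ∎
        where open ≤-Reasoning
      cost : ∀ f g k → 3 * f + (3 * g + k) ≡ 3 * (f + g) + k
      cost = solve-∀

quadratic : ∀ n → 5 * n * suc (n + n + 1) ≤ 10 * suc (n + 1) ^ 2
quadratic n = ≤-trans (m≤m+n _ (30 * n + 40)) (≤-reflexive (expand n))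
  where
    expand : ∀ n → 5 * n * suc (n + n + 1) + (30 * n + 40) ≡ 10 * (suc (n + 1) * (suc (n + 1) * 1))
    expand = solve-∀

module Saturation (N p : ℕ) where

  open Doubling N [ var p ]

  discharge : ∀ {Γ k} c → All (λ x → var x ∈ ⌜ c ⌝ ∷ Γ) (premises c) → lsize (⌜ c ⌝ ∷ Γ) ≤ N →
              map var (conclusions c) ++ Γ ⊢⟨ k ⟩ [ var p ] → ⌜ c ⌝ ∷ Γ ⊢⟨ fireCost c + k ⟩ [ var p ]
  discharge (atom x) _ _ d = d
  discharge {Γ} {k} (fromProd q qs a) present small d =
    recount cost
      (⇒L-from-context (map var (q ∷ qs)) (All-map⁺ present) (fits-++ {Θ = map var (q ∷ qs)} atoms≤N small)
        (product-right q qs (fits (s≤s (≤-trans (+-mono-≤ atoms≤N prod≤N) (m≤m+n _ 1)))))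
        d)
    where
      P = fsize (prod q qs)
      P≤N : P ≤ N
      P≤N = ≤-trans (m≤n⇒m≤1+n (m≤m+n P 1)) (≤-trans (m≤m+n _ (lsize Γ)) small)
      prod≤N : lsize [ prod q qs ] ≤ N
      prod≤N = ≤-trans (≤-reflexive (+-identityʳ P)) P≤N
      atoms≤N : lsize (map var (q ∷ qs)) ≤ N
      atoms≤N = ≤-trans (atoms≤prod q qs) P≤N
      cost : length (map var (q ∷ qs)) + suc (P + k) ≡ fireCost (fromProd q qs a) + k
      cost = trans (cong (_+ suc (P + k)) (length-map var (q ∷ qs))) (sym (+-assoc (length (q ∷ qs)) _ k))
  discharge {Γ} (toProd a q qs) present small d =
    ⇒L-from-context [ var a ] (All-map⁺ present) (fits-++ {Θ = [ var a ]} one≤N small)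
      (axᵇ (var a) (fits-≤ ≤-refl (fits-double {[ var a ]} (≤-trans one≤N (m≤m+n N N)))))
      (product-left q qs (fits-double (≤-trans prodΓ≤ (≤-trans small (m≤m+n N N)))) d)
    where
      one≤N : lsize [ var a ] ≤ N
      one≤N = ≤-trans (s≤s z≤n) small
      prodΓ≤ : lsize (prod q qs ∷ Γ) ≤ lsize (⌜ toProd a q qs ⌝ ∷ Γ)
      prodΓ≤ = +-monoˡ-≤ (lsize Γ) (m≤n+m _ 2)

  fire : ∀ {k} C₁ c C₂ → Enabled (C₁ ++ c ∷ C₂) c → lsize ⟪ C₁ ++ c ∷ C₂ ⟫ ≤ N →
         ⟪ map atom (conclusions c) ++ C₁ ++ C₂ ⟫ ⊢⟨ k ⟩ [ var p ] →
         ⟪ C₁ ++ c ∷ C₂ ⟫ ⊢⟨ fireCost c + k ⟩ [ var p ]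
  fire C₁ c C₂ enabled small d =
    exᵇ (↭-sym picked)
      (discharge c (All.map (∈-resp-↭ picked ∘ ∈-map⁺ ⌜_⌝) (enabled⇒premises c enabled))
        (≤-trans (≤-reflexive (sym (lsize-↭ picked))) small)
        (exᵇ (↭-reflexive (⟪atoms⟫-++ (conclusions c) (C₁ ++ C₂))) d))
    where
      picked = ⟪⟫-pick C₁ c C₂

  lsize-fire : ∀ C₁ c C₂ → lsize ⟪ map atom (conclusions c) ++ C₁ ++ C₂ ⟫ ≤ lsize ⟪ C₁ ++ c ∷ C₂ ⟫
  lsize-fire C₁ c C₂ = begin
    lsize ⟪ map atom (conclusions c) ++ C₁ ++ C₂ ⟫  ≡⟨ cong lsize (⟪atoms⟫-++ (conclusions c) (C₁ ++ C₂)) ⟩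
    lsize (map var (conclusions c) ++ R)            ≡⟨ lsize-++ (map var (conclusions c)) R ⟩
    lsize (map var (conclusions c)) + lsize R       ≤⟨ +-monoˡ-≤ (lsize R) (conclusions≤ c) ⟩
    lsize (⌜ c ⌝ ∷ R)                               ≡⟨ lsize-↭ (↭-sym (⟪⟫-pick C₁ c C₂)) ⟩
    lsize ⟪ C₁ ++ c ∷ C₂ ⟫                          ∎
    where open ≤-Reasoning
          R = ⟪ C₁ ++ C₂ ⟫

  stuck⇒known : ∀ C → ¬ Any (Enabled C) C → ⟪ C ⟫ ⊨ [ var p ] → Known C p
  stuck⇒known C stuck valid = toWitness (singleton⁻ (valid (model C) (model-satisfies C (¬Any⇒All¬ C stuck))))

  saturate : ∀ C → Acc _<_ (budget C) → lsize ⟪ C ⟫ ≤ N → ⟪ C ⟫ ⊨ [ var p ] →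
             ⟪ C ⟫ ⊢⟨ budget C ⟩ [ var p ]
  saturate C _ small valid with Any.any? (enabled? C) C
  saturate C _ small valid | no stuck =
    relax (≤-trans (≤-reflexive (length-map ⌜_⌝ C)) (length≤budget C))
      (ax-∈ (∈-map⁺ ⌜_⌝ (stuck⇒known C stuck valid)) (fits-double (≤-trans small (m≤m+n N N))))
  saturate C (acc smaller) small valid | yes some with C₁ , c , C₂ , refl , enabled ← Any-split some =
    recount (sym (budget-fire C₁ c C₂))
      (fire C₁ c C₂ enabled small
        (saturate C' (smaller decreasing) (≤-trans (lsize-fire C₁ c C₂) small) (fire-preserves-⊨ C₁ c C₂ valid)))
    where
      C' = map atom (conclusions c) ++ C₁ ++ C₂
      decreasing : budget C' < budget (C₁ ++ c ∷ C₂)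
      decreasing = ≤-trans (m<n+m (budget C') (fireCost-pos c enabled)) (≤-reflexive (sym (budget-fire C₁ c C₂)))

  horn-complete : ∀ {Γ} (hs : All Horn Γ) → lsize Γ ≤ N → Γ ⊨ [ var p ] → Γ ⊢⟨ 5 * N ⟩ [ var p ]
  horn-complete {Γ} hs small valid =
    exᵇ (↭-reflexive (++-identityʳ Γ))
      (relax cost (unflattenAll hs (≤-trans (≤-reflexive (cong lsize (++-identityʳ Γ))) small)
        (exᵇ (↭-reflexive (sym (++-identityʳ ⟪ C ⟫)))
          (saturate C (<-wellFounded _) C-small (λ v sat → valid v (flattenAll-sound hs (map⁻ sat)))))))
    where
      C = flattenAll hs
      C-small : lsize ⟪ C ⟫ ≤ N
      C-small = ≤-trans (lsize-flattenAll hs) small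
      five : ∀ n → 3 * n + (n + n) ≡ 5 * n
      five = solve-∀
      cost : 3 * lsize Γ + budget C ≤ 5 * N
      cost = ≤-trans (+-mono-≤ (*-monoʳ-≤ 3 small) (≤-trans (budget≤ C) (+-mono-≤ C-small C-small)))
                     (≤-reflexive (five N))

  horn-quadratic : ∀ {Γ} → All Horn Γ → lsize Γ ≤ N → Γ ⊨ [ var p ] →
                   Σ (Γ ⊢ [ var p ]) (λ d → dsize d ≤ 10 * suc (N + 1) ^ 2)
  horn-quadratic hs small valid with d , size≤ ← horn-complete hs small valid = d , ≤-trans size≤ (quadratic N)

theorem29 : ∃ λ (C : ℕ) → ∀ (Γ : List Fm) (p : ℕ) → All Horn Γ →
    Γ ⊢ [ var p ] →
    Σ (Γ ⊢ [ var p ]) (λ d → dsize d ≤ C * ssize Γ [ var p ] ^ 2)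
theorem29 = 10 , λ Γ p hs d → Saturation.horn-quadratic (lsize Γ) p hs ≤-refl (sound d)
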